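{- Let $n\ge 1$, let $\alpha=a_1\cdots a_{2n}$ and $\beta=b_1\cdots b_{2n}$ be in $\mathbf{C}(n)$, and let $x\in\{0,1\}$. If $(\text{pre}_n(\alpha),\text{pre}_n(\beta))$ is prefix-related with respect to $(x,n)$, then $(\alpha,\beta)$ is prefix-related with respect to $(1-x,n)$.
   Context: Strings are binary, over $\{0,1\}$. For a binary string $\alpha$, $\overline{\alpha}$ is its bitwise complement. A necklace is a string that is lexicographically smallest among all its rotations. A binary string $\gamma$ of length $n$ is a co-necklace if $\gamma\overline{\gamma}$ is a necklace; $\mathbf{coN}(n)=\{\gamma\overline{\gamma}:\gamma\text{ a co-necklace of length } n\}$. $\mathbf{C}(n)$ is the set of all binary $\alpha=a_1\cdots a_{2n}$ such that $a_{i+1}\cdots a_{2n}a_1\cdots a_i\in\mathbf{coN}(n)$, where $i$ is the largest index with $a_i\ne 0$. $\text{pre}_\ell(\alpha)$ is the length-$\ell$ prefix of $\alpha$ (empty for $\ell\le 0$). Prefix-related: for strings $\alpha=a_1\cdots a_s$, $\beta=b_1\cdots b_t$ with $s,t\ge n>0$ and a symbol $x$, let $j$ be the smallest nonnegative integer with $a_{s-j}\ne x$ ($j=\infty$ if none); $(\alpha,\beta)$ is prefix-related with respect to $(x,n)$ if $j\le n$ and $\text{pre}_{n-j-1}(\alpha)=\text{pre}_{n-j-1}(\beta)$. -}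

module Defs where

open import Data.Bool using (Bool; true; false; not)
open import Data.Nat using (ℕ; zero; suc; _+_; _*_; _∸_; _≤_; _<_)
open import Data.List using (List; []; _∷_; _++_; map; take; drop; length; replicate; [_])
open import Data.Product using (Σ; _×_; ∃; ∃-syntax; _,_)
open import Relation.Binary.PropositionalEquality using (_≡_; _≢_)
open import Data.Unit using (⊤)
open import Data.Empty using (⊥)

-- Binary strings: lists of bits, 0 = false, 1 = true.
BStr : Set
BStr = List Bool

compl : BStr → BStr
compl = map not

_≤lex_ : BStr → BStr → Set
[] ≤lex _ = ⊤
(_ ∷ _) ≤lex [] = ⊥
(false ∷ u) ≤lex (false ∷ v) = u ≤lex v
(true ∷ u) ≤lex (true ∷ v) = u ≤lex v
(false ∷ u) ≤lex (true ∷ v) = ⊤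
(true ∷ u) ≤lex (false ∷ v) = ⊥

rot : ℕ → BStr → BStr
rot i s = drop i s ++ take i s

Necklace : BStr → Set
Necklace s = (i : ℕ) → i < length s → s ≤lex rot i s

InCoN : ℕ → BStr → Set
InCoN n s = Σ BStr λ γ → length γ ≡ n × s ≡ γ ++ compl γ × Necklace (γ ++ compl γ)

-- membership in C(n): α = a_1..a_{2n}; writing α = ρ ++ 1 ++ 0^k, the index
-- i = |ρ|+1 is the largest index with a_i ≠ 0, and we require
-- a_{i+1}..a_{2n} a_1..a_i = 0^k ++ ρ ++ 1 ∈ coN(n).
InC : ℕ → BStr → Set
InC n α = length α ≡ 2 * n ×
  Σ BStr λ ρ → Σ ℕ λ k → α ≡ ρ ++ true ∷ replicate k false
    × InCoN n (replicate k false ++ ρ ++ [ true ])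

-- prefix of length ℓ (empty for ℓ ≤ 0; ℕ subtraction truncates at 0)
pre : ℕ → BStr → BStr
pre = take

-- (α, β) prefix-related w.r.t. (x, n): lengths ≥ n > 0, and the smallest j with
-- a_{s-j} ≠ x exists (α = ρ ++ y ∷ x^j with y ≠ x, which determines j uniquely),
-- satisfies j ≤ n, and pre_{n-j-1}(α) = pre_{n-j-1}(β).
PrefixRelated : Bool → ℕ → BStr → BStr → Set
PrefixRelated x n α β =
  0 < n × n ≤ length α × n ≤ length β ×
  Σ ℕ λ j → Σ BStr λ ρ → Σ Bool λ y →
    α ≡ ρ ++ y ∷ replicate j x × y ≢ x × j ≤ n ×
    pre (n ∸ suc j) α ≡ pre (n ∸ suc j) β

module Submission where

-- Every string of C(n) has the form  w w̄  with |w| = n: it is a rotation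
-- of some γ γ̄ ∈ coN(n), and the shape "u ū with |u| = n" is invariant under
-- rotating by one symbol (b t = u ū  gives  t b = u' ū'  with  u' = tail u ++ b̄).
-- Hence pre_n(α) = w and pre_n(β) = v, where α = w w̄ and β = v v̄.
-- If w = ρ y x^j with y ≠ x, then w̄ = ρ̄ x (x̄)^j, so α = (w ρ̄) x (x̄)^j:
-- the trailing run of α with respect to 1-x has the same length j.  The
-- prefix condition pre_{n-j-1}(w) = pre_{n-j-1}(v) lifts to α, β because
-- n-j-1 ≤ n.

open import Defs
open import Data.Bool using (Bool; not; true; false)
open import Data.Bool.Properties using (not-involutive; ¬-not; not-¬)
open import Data.Nat using (ℕ; _≤_; zero; suc; _∸_)
open import Data.Nat.Properties using (m≤n⇒m⊓n≡m; m∸n≤m; m≤m+n; +-comm)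
open import Data.List using (List; []; _∷_; _++_; map; take; length; replicate; [_])
open import Data.List.Properties
  using (map-++; map-replicate; ++-assoc; ++-identityʳ; take-take; length-++)
open import Data.Product using (Σ; _×_; _,_)
open import Relation.Binary.PropositionalEquality
  using (_≡_; _≢_; refl; sym; trans; cong; subst; module ≡-Reasoning)

Antiperiodic : ℕ → BStr → Set
Antiperiodic n s = Σ BStr λ w → length w ≡ n × s ≡ w ++ compl w

-- Moving the first symbol to the end preserves antiperiodicity:
-- (b w') (b̄ w̄') rotated by one is (w' b̄) (w̄' b), the doubling of w' b̄.
rotate-antiperiodic : ∀ {n} b t → Antiperiodic n (b ∷ t) → Antiperiodic n (t ++ [ b ])
rotate-antiperiodic b ._ (.b ∷ w' , refl , refl) =
  w' ++ [ not b ] , length-snoc w' , doubling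
  where
  length-snoc : ∀ (u : BStr) → length (u ++ [ not b ]) ≡ suc (length u)
  length-snoc u = trans (length-++ u) (+-comm (length u) 1)

  doubling : (w' ++ not b ∷ compl w') ++ [ b ] ≡ (w' ++ [ not b ]) ++ compl (w' ++ [ not b ])
  doubling = begin
      (w' ++ not b ∷ compl w') ++ [ b ]
    ≡⟨ ++-assoc w' (not b ∷ compl w') [ b ] ⟩
      w' ++ not b ∷ (compl w' ++ [ b ])
    ≡⟨ cong (λ z → w' ++ not b ∷ (compl w' ++ [ z ])) (sym (not-involutive b)) ⟩
      w' ++ [ not b ] ++ compl w' ++ compl [ not b ]
    ≡⟨ cong (λ z → w' ++ [ not b ] ++ z) (sym (map-++ not w' [ not b ])) ⟩
      w' ++ [ not b ] ++ compl (w' ++ [ not b ])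
    ≡⟨ sym (++-assoc w' [ not b ] _) ⟩
      (w' ++ [ not b ]) ++ compl (w' ++ [ not b ])
    ∎
    where open ≡-Reasoning

rotate-block-antiperiodic : ∀ {n} c k r →
  Antiperiodic n (replicate k c ++ r) → Antiperiodic n (r ++ replicate k c)
rotate-block-antiperiodic c zero r a =
  subst (Antiperiodic _) (sym (++-identityʳ r)) a
rotate-block-antiperiodic c (suc k) r a =
  subst (Antiperiodic _) (++-assoc r [ c ] (replicate k c))
    (rotate-block-antiperiodic c k (r ++ [ c ])
      (subst (Antiperiodic _) (++-assoc (replicate k c) r [ c ])
        (rotate-antiperiodic c (replicate k c ++ r) a)))

-- Every α ∈ C(n) is antiperiodic: α = ρ 1 0^k and its rotation 0^k ρ 1 is
-- some γ γ̄ ∈ coN(n).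
C⇒antiperiodic : ∀ n α → InC n α → Antiperiodic n α
C⇒antiperiodic n ._ (_ , ρ , k , refl , γ , |γ| , rotation≡ , _) =
  subst (Antiperiodic n) (++-assoc ρ [ true ] (replicate k false))
    (rotate-block-antiperiodic false k (ρ ++ [ true ]) (γ , |γ| , rotation≡))

antiperiodic-length : ∀ {n} s → Antiperiodic n s → n ≤ length s
antiperiodic-length _ (w , refl , refl) = subst (length w ≤_) (sym (length-++ w)) (m≤m+n _ _)

take-length-++ : ∀ (w v : BStr) → take (length w) (w ++ v) ≡ w
take-length-++ []      v = refl
take-length-++ (c ∷ w) v = cong (c ∷_) (take-length-++ w v)

take-of-take : ∀ {m n} (s : BStr) → m ≤ n → take m (take n s) ≡ take m s
take-of-take {m} {n} s m≤n = trans (take-take m n s) (cong (λ k → take k s) (m≤n⇒m⊓n≡m m≤n))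

compl-trailing-run : ∀ ρ j {x y} → y ≢ x →
  compl (ρ ++ y ∷ replicate j x) ≡ compl ρ ++ x ∷ replicate j (not x)
compl-trailing-run ρ j {x} {y} y≢x = begin
    compl (ρ ++ y ∷ replicate j x)
  ≡⟨ map-++ not ρ (y ∷ replicate j x) ⟩
    compl ρ ++ not y ∷ compl (replicate j x)
  ≡⟨ cong (λ z → compl ρ ++ z ∷ compl (replicate j x)) not-y≡x ⟩
    compl ρ ++ x ∷ compl (replicate j x)
  ≡⟨ cong (λ z → compl ρ ++ x ∷ z) (map-replicate not j x) ⟩
    compl ρ ++ x ∷ replicate j (not x)
  ∎
  where
  open ≡-Reasoning
  not-y≡x : not y ≡ x
  not-y≡x = trans (cong not (¬-not y≢x)) (not-involutive x)

lemma2 : (n : ℕ) → 1 ≤ n → (α β : BStr) → InC n α → InC n β → (x : Bool) →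
    PrefixRelated x n (pre n α) (pre n β) → PrefixRelated (not x) n α β
lemma2 n _ α β cα cβ x (0<n , _ , _ , j , ρ , y , w≡ρyxʲ , y≢x , j≤n , pre-w≡pre-v)
  with C⇒antiperiodic n α cα | C⇒antiperiodic n β cβ
... | aα@(w , refl , refl) | aβ@(v , _ , refl) =
  0<n , antiperiodic-length α aα , antiperiodic-length β aβ ,
  j , w ++ compl ρ , x , α-run , not-¬ refl , j≤n , pre-α≡pre-β
  where
  m = n ∸ suc j
  w≡ : w ≡ ρ ++ y ∷ replicate j x
  w≡ = trans (sym (take-length-++ w (compl w))) w≡ρyxʲ

  α-run : w ++ compl w ≡ (w ++ compl ρ) ++ x ∷ replicate j (not x)
  α-run = begin
      w ++ compl w
    ≡⟨ cong (λ u → w ++ compl u) w≡ ⟩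
      w ++ compl (ρ ++ y ∷ replicate j x)
    ≡⟨ cong (w ++_) (compl-trailing-run ρ j y≢x) ⟩
      w ++ compl ρ ++ x ∷ replicate j (not x)
    ≡⟨ sym (++-assoc w (compl ρ) _) ⟩
      (w ++ compl ρ) ++ x ∷ replicate j (not x)
    ∎
    where open ≡-Reasoning

  pre-α≡pre-β : take m α ≡ take m β
  pre-α≡pre-β = begin
      take m α              ≡⟨ sym (take-of-take α (m∸n≤m n (suc j))) ⟩
      take m (take n α)     ≡⟨ pre-w≡pre-v ⟩
      take m (take n β)     ≡⟨ take-of-take β (m∸n≤m n (suc j)) ⟩
      take m β              ∎
    where open ≡-Reasoning
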